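{- Let $A$ be a vertex of $H_{\aleph_0}$, let $H(A)$ be the connected component of $H_{\aleph_0}$ containing $A$, and let $f$ be the restriction to $H(A)$ of an automorphism of $H_{\aleph_0}$. For $Z\in H(A)$ let $s_Z$ be a symplectic permutation of $\mathbb{Z}\setminus\{0\}$ such that $f(W)=s_Z(W)$ for all $W\in Z^{\sim}$, where $Z^{\sim}$ denotes the set consisting of $Z$ and all vertices of $H_{\aleph_0}$ adjacent to $Z$. If $X,Y\in H(A)$ are adjacent, then $s_X=s_Y$.
   Context: A subset $X\subset\mathbb{Z}\setminus\{0\}$ is called singular if $i\in X$ implies $-i\notin X$; a maximal singular subset is one containing exactly one of $i,-i$ for every natural $i$. Two maximal singular subsets $X,Y$ are adjacent if $|X\setminus Y|=|Y\setminus X|=1$. The graph $H_{\aleph_0}$ has as vertices all maximal singular subsets of $\mathbb{Z}\setminus\{0\}$ and as edges the adjacent pairs. A permutation $s$ of $\mathbb{Z}\setminus\{0\}$ is symplectic if $s(-i)=-s(i)$ for all $i$; it maps maximal singular subsets to maximal singular subsets. -}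

module Defs where

open import Data.Bool using (Bool; true; false; not)
open import Data.Nat using (ℕ)
open import Data.Product using (Σ; _×_; _,_; proj₁; ∃-syntax)
open import Data.Sum using (_⊎_)
open import Relation.Binary.PropositionalEquality using (_≡_)

-- ℤ ∖ {0}: a sign (true = positive) and n : ℕ, encoding ±(n+1).
NZ : Set
NZ = Bool × ℕ

neg : NZ → NZ
neg (b , n) = (not b , n)

Subset : Set
Subset = NZ → Bool

MaxSingular : Subset → Set
MaxSingular X = ∀ x → X (neg x) ≡ not (X x)

Vertex : Set
Vertex = Σ Subset MaxSingular

_≈_ : Vertex → Vertex → Set
X ≈ Y = ∀ x → proj₁ X x ≡ proj₁ Y x

DiffSingleton : Subset → Subset → Set
DiffSingleton X Y =
  ∃[ x ] ((X x ≡ true) × (Y x ≡ false) ×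
          (∀ z → X z ≡ true → Y z ≡ false → z ≡ x))

Adj : Vertex → Vertex → Set
Adj X Y = DiffSingleton (proj₁ X) (proj₁ Y) × DiffSingleton (proj₁ Y) (proj₁ X)

InStar : Vertex → Vertex → Set
InStar Z W = (W ≈ Z) ⊎ Adj Z W

data Reach (A : Vertex) : Vertex → Set where
  here : Reach A A
  step : ∀ {Y Z} → Reach A Y → Adj Y Z → Reach A Z

record Aut : Set where
  field
    to       : Vertex → Vertex
    from     : Vertex → Vertex
    to-cong  : ∀ {X Y} → X ≈ Y → to X ≈ to Y
    from-cong : ∀ {X Y} → X ≈ Y → from X ≈ from Y
    to-from  : ∀ X → to (from X) ≈ X
    from-to  : ∀ X → from (to X) ≈ X
    adj-to   : ∀ X Y → Adj X Y → Adj (to X) (to Y)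
    adj-from : ∀ X Y → Adj (to X) (to Y) → Adj X Y

record SymPerm : Set where
  field
    to      : NZ → NZ
    from    : NZ → NZ
    to-from : ∀ x → to (from x) ≡ x
    from-to : ∀ x → from (to x) ≡ x
    to-neg  : ∀ x → to (neg x) ≡ neg (to x)

image : SymPerm → Subset → Subset
image s W y = W (SymPerm.from s y)

image-maxsing : ∀ s W → MaxSingular W → MaxSingular (image s W)
image-maxsing s W m y = trans (cong W e) (m (SymPerm.from s y))
  where
  open import Relation.Binary.PropositionalEquality
  u = SymPerm.from s y
  e : SymPerm.from s (neg y) ≡ neg u
  e = trans (cong (λ t → SymPerm.from s (neg t)) (sym (SymPerm.to-from s y)))
       (trans (cong (SymPerm.from s) (sym (SymPerm.to-neg s u)))
              (SymPerm.from-to s (neg u)))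

act : SymPerm → Vertex → Vertex
act s (W , m) = image s W , image-maxsing s W m

-- A symplectic permutation s acts on the pairs ±i, and it turns flipping the pair ±j of W into
-- flipping the pair s(±j) of s(W). If X and Y differ in the pair ±m, then flipping one more pair ±j
-- in both gives adjacent neighbours of X and Y, whose images under f are again adjacent; comparing
-- these images (and, for j = m, the images of X and Y themselves) shows that s_X and s_Y act in the
-- same way on pairs. As s_X(X) = f(X) = s_Y(X), they also agree on signs, so s_X = s_Y.
module Submission where

open import Defs
open import Data.Bool using (Bool; true; false; not)
open import Data.Bool.Properties using (not-involutive; not-¬)
open import Data.Nat using (ℕ; _≟_)
open import Data.Product using (Σ; _×_; _,_; proj₁; proj₂; swap)
open import Data.Sum using (_⊎_; inj₁; inj₂)
open import Data.Empty using (⊥-elim)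
open import Function using (id)
open import Relation.Nullary using (¬_; Dec; yes; no)
open import Relation.Binary.PropositionalEquality
import Relation.Binary.Reasoning.Setoid as SetoidReasoning

idx : NZ → ℕ
idx = proj₂

⟦_⟧ : Vertex → Subset
⟦_⟧ = proj₁

≢-not : ∀ {x y w} → x ≡ w → y ≡ not w → ¬ x ≡ y
≢-not p q e = not-¬ refl (trans (sym p) (trans e q))

idx-≡ : (u v : NZ) → idx u ≡ idx v → u ≡ v ⊎ u ≡ neg v
idx-≡ (true  , n) (true  , .n) refl = inj₁ refl
idx-≡ (false , n) (false , .n) refl = inj₁ refl
idx-≡ (true  , n) (false , .n) refl = inj₂ refl
idx-≡ (false , n) (true  , .n) refl = inj₂ refl

idx-∈-injective : (X : Vertex) (u v : NZ) → idx u ≡ idx v → ⟦ X ⟧ u ≡ ⟦ X ⟧ v → u ≡ v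
idx-∈-injective X u v p e with idx-≡ u v p
... | inj₁ u≡v = u≡v
... | inj₂ refl = ⊥-elim (not-¬ refl (trans (sym e) (proj₂ X v)))

differ-at-idx : (X Y : Vertex) (u v : NZ) → idx u ≡ idx v →
                ⟦ Y ⟧ v ≡ not (⟦ X ⟧ v) → ⟦ Y ⟧ u ≡ not (⟦ X ⟧ u)
differ-at-idx X Y u v p d with idx-≡ u v p
... | inj₁ refl = d
... | inj₂ refl = trans (proj₂ Y v) (cong not (trans d (sym (proj₂ X v))))

∈-at-idx : (X : Vertex) (m : ℕ) → Σ NZ λ x → idx x ≡ m × ⟦ X ⟧ x ≡ true
∈-at-idx X m with ⟦ X ⟧ (true , m) in e
... | true  = (true , m) , refl , e
... | false = (false , m) , refl , trans (proj₂ X (true , m)) (cong not e)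

toggleIf : {A : Set} → Dec A → Bool → Bool
toggleIf (yes _) = not
toggleIf (no  _) = id

-- Index k stands for the pair ±(k+1); flip k exchanges which of the two lies in the vertex.
flip : ℕ → Vertex → Vertex
flip k X = toggled , singular
  where
  toggled : Subset
  toggled z = toggleIf (idx z ≟ k) (⟦ X ⟧ z)

  singular : MaxSingular toggled
  singular z with idx z ≟ k
  ... | yes _ = cong not (proj₂ X z)
  ... | no  _ = proj₂ X z

flip-on : ∀ {k} X z → idx z ≡ k → ⟦ flip k X ⟧ z ≡ not (⟦ X ⟧ z)
flip-on {k} X z p with idx z ≟ k
... | yes _ = refl
... | no ¬p = ⊥-elim (¬p p)

flip-off : ∀ {k} X z → ¬ idx z ≡ k → ⟦ flip k X ⟧ z ≡ ⟦ X ⟧ z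
flip-off {k} X z ¬p with idx z ≟ k
... | yes p = ⊥-elim (¬p p)
... | no  _ = refl

flip-moved : ∀ k X z → ¬ ⟦ flip k X ⟧ z ≡ ⟦ X ⟧ z → idx z ≡ k
flip-moved k X z moved with idx z ≟ k
... | yes p = p
... | no  _ = ⊥-elim (moved refl)

flip-cong : ∀ k {X Y} → X ≈ Y → flip k X ≈ flip k Y
flip-cong k e z = cong (toggleIf (idx z ≟ k)) (e z)

flip-involutive : ∀ k X → flip k (flip k X) ≈ X
flip-involutive k X z with idx z ≟ k
... | yes _ = not-involutive _
... | no  _ = refl

flip-comm : ∀ a b X → flip a (flip b X) ≈ flip b (flip a X)
flip-comm a b X z with idx z ≟ a | idx z ≟ b
... | yes _ | yes _ = refl
... | yes _ | no  _ = refl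
... | no  _ | yes _ = refl
... | no  _ | no  _ = refl

flip-sym : ∀ m X Y → Y ≈ flip m X → X ≈ flip m Y
flip-sym m X Y e z =
  trans (sym (flip-involutive m X z)) (flip-cong m {flip m X} {Y} (λ w → sym (e w)) z)

diffSingleton⇒flip : ∀ X Y → DiffSingleton ⟦ X ⟧ ⟦ Y ⟧ → Σ ℕ λ m → Y ≈ flip m X
diffSingleton⇒flip X Y (x , Xx , Yx , unique) = idx x , agree
  where
  off-pair : ∀ z → ¬ idx z ≡ idx x → ⟦ Y ⟧ z ≡ ⟦ X ⟧ z
  off-pair z ¬p with ⟦ X ⟧ z in Xz | ⟦ Y ⟧ z in Yz
  ... | true  | true  = refl
  ... | false | false = refl
  ... | true  | false = ⊥-elim (¬p (cong idx (unique z Xz Yz)))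
  ... | false | true  = ⊥-elim (¬p (cong idx (unique (neg z)
                          (trans (proj₂ X z) (cong not Xz)) (trans (proj₂ Y z) (cong not Yz)))))

  agree : Y ≈ flip (idx x) X
  agree z with idx z ≟ idx x
  ... | yes p = differ-at-idx X Y z x p (trans Yx (cong not (sym Xx)))
  ... | no ¬p = off-pair z ¬p

flip⇒diffSingleton : ∀ m X Y → Y ≈ flip m X → DiffSingleton ⟦ X ⟧ ⟦ Y ⟧
flip⇒diffSingleton m X Y e with ∈-at-idx X m
... | x , refl , Xx = x , Xx , trans (e x) (trans (flip-on X x refl) (cong not Xx)) , unique
  where
  unique : ∀ z → ⟦ X ⟧ z ≡ true → ⟦ Y ⟧ z ≡ false → z ≡ x
  unique z Xz Yz = idx-∈-injective X z x (flip-moved m X z moved) (trans Xz (sym Xx))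
    where
    moved : ¬ ⟦ flip m X ⟧ z ≡ ⟦ X ⟧ z
    moved q with trans (sym Yz) (trans (e z) (trans q Xz))
    ... | ()

adj⇒flip : ∀ X Y → Adj X Y → Σ ℕ λ m → Y ≈ flip m X
adj⇒flip X Y (X∖Y , _) = diffSingleton⇒flip X Y X∖Y

flip⇒adj : ∀ m X Y → Y ≈ flip m X → Adj X Y
flip⇒adj m X Y e = flip⇒diffSingleton m X Y e , flip⇒diffSingleton m Y X (flip-sym m X Y e)

adj-flip : ∀ k {X Y} → Adj X Y → Adj (flip k X) (flip k Y)
adj-flip k {X} {Y} XY with adj⇒flip X Y XY
... | m , e = flip⇒adj m (flip k X) (flip k Y)
                 λ z → trans (flip-cong k {Y} {flip m X} e z) (flip-comm k m X z)

adj-differ-idx : ∀ {P Q} → Adj P Q → ∀ u v →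
                 ¬ ⟦ P ⟧ u ≡ ⟦ Q ⟧ u → ¬ ⟦ P ⟧ v ≡ ⟦ Q ⟧ v → idx u ≡ idx v
adj-differ-idx {P} {Q} PQ u v du dv with adj⇒flip P Q PQ
... | m , e = trans (moved u du) (sym (moved v dv))
  where
  moved : ∀ z → ¬ ⟦ P ⟧ z ≡ ⟦ Q ⟧ z → idx z ≡ m
  moved z dz = flip-moved m P z (λ q → dz (sym (trans (e z) q)))

flip-flip-≈ : ∀ a b V → flip a (flip b V) ≈ V → a ≡ b
flip-flip-≈ a b V e with a ≟ b
... | yes a≡b = a≡b
... | no  a≢b = ⊥-elim (not-¬ refl (trans (sym (e (true , a)))
                  (trans (flip-on (flip b V) (true , a) refl) (cong not (flip-off V (true , a) a≢b)))))

-- flip a V and flip b (flip c V) differ at index c, and also at index a unless a = b.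
adj-flip-flip : ∀ a b c V {P Q} → Adj P Q → P ≈ flip a V → Q ≈ flip b (flip c V) →
                ¬ a ≡ c → ¬ b ≡ c → a ≡ b
adj-flip-flip a b c V {P} {Q} PQ eP eQ a≢c b≢c with a ≟ b
... | yes a≡b = a≡b
... | no  a≢b =
  ⊥-elim (a≢c (sym (adj-differ-idx {P} {Q} PQ (true , c) (true , a) differ-c differ-a)))
  where
  differ-c : ¬ ⟦ P ⟧ (true , c) ≡ ⟦ Q ⟧ (true , c)
  differ-c = ≢-not (trans (eP (true , c)) (flip-off V (true , c) (λ q → a≢c (sym q))))
                   (trans (eQ (true , c))
                     (trans (flip-off (flip c V) (true , c) (λ q → b≢c (sym q)))
                            (flip-on V (true , c) refl)))
  differ-a : ¬ ⟦ P ⟧ (true , a) ≡ ⟦ Q ⟧ (true , a)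
  differ-a e = ≢-not (trans (eQ (true , a)) (trans (flip-off (flip c V) (true , a) a≢b)
                                                         (flip-off V (true , a) a≢c)))
                         (trans (eP (true , a)) (flip-on V (true , a) refl)) (sym e)

_⁻¹ : SymPerm → SymPerm
s ⁻¹ = record { to = from ; from = to ; to-from = from-to ; from-to = to-from ; to-neg = from-neg }
  where
  open SymPerm s
  from-neg : ∀ y → from (neg y) ≡ neg (from y)
  from-neg y = begin
    from (neg y)               ≡⟨ cong (λ t → from (neg t)) (sym (to-from y)) ⟩
    from (neg (to (from y)))   ≡⟨ cong from (sym (to-neg (from y))) ⟩
    from (to (neg (from y)))   ≡⟨ from-to (neg (from y)) ⟩
    neg (from y)               ∎
    where open ≡-Reasoning

idx-to-cong : ∀ s u v → idx u ≡ idx v → idx (SymPerm.to s u) ≡ idx (SymPerm.to s v)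
idx-to-cong s u v p with idx-≡ u v p
... | inj₁ refl = refl
... | inj₂ refl = cong idx (SymPerm.to-neg s v)

idx-to-injective : ∀ s u v → idx (SymPerm.to s u) ≡ idx (SymPerm.to s v) → idx u ≡ idx v
idx-to-injective s u v p =
  subst₂ (λ a b → idx a ≡ idx b) (SymPerm.from-to s u) (SymPerm.from-to s v)
         (idx-to-cong (s ⁻¹) _ _ p)

act-cong : ∀ s {X Y} → X ≈ Y → act s X ≈ act s Y
act-cong s e y = e (SymPerm.from s y)

act-flip : ∀ s W z → act s (flip (idx z) W) ≈ flip (idx (SymPerm.to s z)) (act s W)
act-flip s W z y with idx (from y) ≟ idx z | idx y ≟ idx (to z)
  where open SymPerm s
... | yes _ | yes _ = refl
... | no  _ | no  _ = refl
... | yes p | no ¬q =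
  ⊥-elim (¬q (trans (sym (cong idx (SymPerm.to-from s y))) (idx-to-cong s _ z p)))
... | no ¬p | yes q =
  ⊥-elim (¬p (trans (idx-to-cong (s ⁻¹) y _ q) (cong idx (SymPerm.from-to s z))))

module _ (F : Vertex → Vertex) where

  AgreeOnStar : SymPerm → Vertex → Set
  AgreeOnStar s Z = ∀ W → InStar Z W → F W ≈ act s W

  in-own-star : ∀ Z → InStar Z Z
  in-own-star Z = inj₁ λ _ → refl

  agree-sign : ∀ s Z → AgreeOnStar s Z → ∀ {W} → InStar Z W →
               ∀ x → ⟦ F W ⟧ (SymPerm.to s x) ≡ ⟦ W ⟧ x
  agree-sign s Z agree {W} ZW x =
    trans (agree W ZW (SymPerm.to s x)) (cong ⟦ W ⟧ (SymPerm.from-to s x))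

  agree-flip : ∀ s Z → AgreeOnStar s Z →
               ∀ W u → W ≈ flip (idx u) Z → F W ≈ flip (idx (SymPerm.to s u)) (F Z)
  agree-flip s Z agree W u e = begin
    ⟦ F W ⟧                                  ≈⟨ agree W (inj₂ (flip⇒adj (idx u) Z W e)) ⟩
    ⟦ act s W ⟧                              ≈⟨ act-cong s {W} {flip (idx u) Z} e ⟩
    ⟦ act s (flip (idx u) Z) ⟧               ≈⟨ act-flip s Z u ⟩
    ⟦ flip (idx (SymPerm.to s u)) (act s Z) ⟧ ≈⟨ flip-cong _ {act s Z} {F Z}
                                                     (λ y → sym (agree Z (in-own-star Z) y)) ⟩
    ⟦ flip (idx (SymPerm.to s u)) (F Z) ⟧     ∎
    where open SetoidReasoning (NZ →-setoid Bool)

  adjacent-stars-same-permutation :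
    (∀ P Q → Adj P Q → Adj (F P) (F Q)) →
    ∀ s t X Y → Adj X Y → AgreeOnStar s X → AgreeOnStar t Y →
    ∀ x → SymPerm.to s x ≡ SymPerm.to t x
  adjacent-stars-same-permutation F-adj s t X Y XY F≈s F≈t x =
    idx-∈-injective (F X) (to s x) (to t x) (same-idx x)
      (trans (agree-sign s X F≈s (in-own-star X) x) (sym (agree-sign t Y F≈t (inj₂ (swap XY)) x)))
    where
    open SymPerm
    m : ℕ
    m = proj₁ (adj⇒flip X Y XY)

    Y≈flip : Y ≈ flip m X
    Y≈flip = proj₂ (adj⇒flip X Y XY)

    w : NZ
    w = true , m

    c : ℕ
    c = idx (to s w)

    FY≈flip : F Y ≈ flip c (F X)
    FY≈flip = agree-flip s X F≈s Y w Y≈flip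

    flip-FY : ∀ b → flip b (F Y) ≈ flip b (flip c (F X))
    flip-FY b = flip-cong b {F Y} {flip c (F X)} FY≈flip

    same-idx-at-m : c ≡ idx (to t w)
    same-idx-at-m = sym (flip-flip-≈ (idx (to t w)) c (F X) λ y → sym (trans (FX≈flip y) (flip-FY _ y)))
      where
      FX≈flip : F X ≈ flip (idx (to t w)) (F Y)
      FX≈flip = agree-flip t Y F≈t X w (flip-sym m X Y Y≈flip)

    same-idx : ∀ z → idx (to s z) ≡ idx (to t z)
    same-idx z with idx z ≟ m
    ... | yes p = trans (idx-to-cong s z w p) (trans same-idx-at-m (sym (idx-to-cong t z w p)))
    ... | no ¬p = adj-flip-flip (idx (to s z)) (idx (to t z)) c (F X) {F X′} {F Y′}
                    (F-adj X′ Y′ (adj-flip (idx z) {X} {Y} XY))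
                    (agree-flip s X F≈s X′ z (λ _ → refl))
                    (λ y → trans (agree-flip t Y F≈t Y′ z (λ _ → refl) y) (flip-FY _ y))
                    (λ q → ¬p (idx-to-injective s z w q))
                    (λ q → ¬p (idx-to-injective t z w (trans q same-idx-at-m)))
      where
      X′ Y′ : Vertex
      X′ = flip (idx z) X
      Y′ = flip (idx z) Y

lemma2 : (A : Vertex) (f : Aut) (s : Vertex → SymPerm) →
    (∀ Z → Reach A Z → ∀ W → InStar Z W → Aut.to f W ≈ act (s Z) W) →
    ∀ X Y → Reach A X → Reach A Y → Adj X Y →
    ∀ x → SymPerm.to (s X) x ≡ SymPerm.to (s Y) x
lemma2 A f s agree X Y reachX reachY XY =
  adjacent-stars-same-permutation (Aut.to f) (Aut.adj-to f) (s X) (s Y) X Y XY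
    (agree X reachX) (agree Y reachY)
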